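{- If $o$ is a $\lambda\mu\mathtt{s}$-object and $o\to_{\lambda\mu\mathtt{s}}o'$, then $o{\downarrow}\to^{*}_{\lambda\mu}o'{\downarrow}$.
   Context: $\lambda\mu$: terms $t,u::=x\mid\lambda x.t\mid t\,u\mid\mu\alpha.c$, commands $c::=[\alpha]t$, objects $o::=t\mid c$; $\lambda x$ binds $x$, $\mu\alpha$ binds $\alpha$; $\mathrm{fn}([\alpha]t)=\mathrm{fn}(t)\cup\{\alpha\}$; objects up to renaming of bound symbols. $o\{x/u\}$ is capture-avoiding substitution; replacement $o\{\alpha/\!\!/u\}$: $x\{\alpha/\!\!/u\}=x$, homomorphic on abstraction, application and $\mu\gamma$, $([\gamma]t)\{\alpha/\!\!/u\}=[\gamma](t\{\alpha/\!\!/u\})$ for $\gamma\neq\alpha$, $([\alpha]t)\{\alpha/\!\!/u\}=[\alpha]((t\{\alpha/\!\!/u\})\,u)$. The fresh replacement $o\{\alpha/\!\!/\gamma.u\}$ is defined like $o\{\alpha/\!\!/u\}$ except $([\alpha]t)\{\alpha/\!\!/\gamma.u\}=[\gamma]((t\{\alpha/\!\!/\gamma.u\})\,u)$. $\to_{\lambda\mu}$ is the closure under all contexts of $(\lambda x.t)u\to t\{x/u\}$ and $(\mu\alpha.c)u\to\mu\alpha.(c\{\alpha/\!\!/u\})$; $\to^{*}$ is its reflexive-transitive closure. $\lambda\mu\mathtt{s}$ extends the syntax with $t[x/u]$ (binds $x$ in $t$) and commands $c\langle\alpha/\!\!/\beta.u\rangle$ (binds $\alpha$ in $c$; $\mathrm{fn}=(\mathrm{fn}(c)\setminus\{\alpha\})\cup\{\beta\}\cup\mathrm{fn}(u)$);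 $|o|_x$, $|o|_\alpha$ count free occurrences. Contexts: $\mathtt{L}::=\Box\mid\mathtt{L}[x/u]$; $\mathtt{TT}::=\Box\mid\lambda x.\mathtt{TT}\mid\mathtt{TT}\,t\mid t\,\mathtt{TT}\mid\mu\alpha.\mathtt{CT}\mid\mathtt{TT}[x/t]\mid t[x/\mathtt{TT}]$, $\mathtt{CT}::=[\alpha]\mathtt{TT}\mid\mathtt{CT}\langle\alpha/\!\!/\beta.u\rangle\mid c\langle\alpha/\!\!/\beta.\mathtt{TT}\rangle$; $\mathtt{TC}::=\lambda x.\mathtt{TC}\mid\mathtt{TC}\,t\mid t\,\mathtt{TC}\mid\mu\alpha.\mathtt{CC}\mid\mathtt{TC}[x/t]\mid t[x/\mathtt{TC}]$, $\mathtt{CC}::=\boxdot\mid[\alpha]\mathtt{TC}\mid\mathtt{CC}\langle\alpha/\!\!/\beta.u\rangle\mid c\langle\alpha/\!\!/\beta.\mathtt{TC}\rangle$. $\to_{\lambda\mu\mathtt{s}}$ is the closure under all contexts of: $\mathtt{L}[\lambda x.t]\,u\to\mathtt{L}[t[x/u]]$; $\mathtt{TT}[x][x/u]\to\mathtt{TT}[u][x/u]$ if $|\mathtt{TT}[x]|_x>1$; $\mathtt{TT}[x][x/u]\to\mathtt{TT}[u]$ if $|\mathtt{TT}[x]|_x=1$; $t[x/u]\to t$ if $x\notin\mathrm{fv}(t)$; $\mathtt{L}[\mu\alpha.c]\,u\to\mathtt{L}[\mu\gamma.c\langle\alpha/\!\!/\gamma.u\rangle]$, $\gamma$ fresh; $\mathtt{CC}[[\alpha]t]\langle\alpha/\!\!/\gamma.u\rangle\to\mathtt{CC}[[\gamma]t\,u]\langle\alpha/\!\!/\gamma.u\rangle$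 if $|\mathtt{CC}[[\alpha]t]|_\alpha>1$; $\mathtt{CC}[[\alpha]t]\langle\alpha/\!\!/\gamma.u\rangle\to\mathtt{CC}[[\gamma]t\,u]$ if $|\mathtt{CC}[[\alpha]t]|_\alpha=1$; $c\langle\alpha/\!\!/\gamma.u\rangle\to c$ if $\alpha\notin\mathrm{fn}(c)$; $\mathtt{TT}$ does not bind $x$, $\mathtt{CC}$ does not bind $\alpha,\gamma$. The projection $\downarrow$ from $\lambda\mu\mathtt{s}$-objects to $\lambda\mu$-objects computes all explicit operators: it is homomorphic on $x$, $\lambda x.t$, $t\,u$, $\mu\alpha.c$, $[\alpha]t$, and $t[x/u]{\downarrow}=t{\downarrow}\{x/u{\downarrow}\}$, $c\langle\alpha/\!\!/\alpha'.u\rangle{\downarrow}=c{\downarrow}\{\alpha/\!\!/\alpha'.u{\downarrow}\}$. -}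

module Defs where

-- Well-scoped de Bruijn representation: objects up to renaming of bound
-- symbols.  Tm n m / Cmd n m : n term variables and m names in scope.

open import Data.Nat using (ℕ; zero; suc; _+_; _>_)
open import Data.Fin using (Fin; zero; suc; _≟_)
open import Data.Product using (_×_)
open import Relation.Nullary using (yes; no)
open import Relation.Binary.PropositionalEquality using (_≡_)
open import Relation.Binary.Construct.Closure.ReflexiveTransitive using (Star)

Ren : ℕ → ℕ → Set
Ren n n' = Fin n → Fin n'

lift : ∀ {n n'} → Ren n n' → Ren (suc n) (suc n')
lift ρ zero    = zero
lift ρ (suc i) = suc (ρ i)

idR : ∀ {n} → Ren n n
idR i = i

module LM where

  mutual
    data Tm : ℕ → ℕ → Set where
      var : ∀ {n m} → Fin n → Tm n m
      lam : ∀ {n m} → Tm (suc n) m → Tm n m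
      app : ∀ {n m} → Tm n m → Tm n m → Tm n m
      mu  : ∀ {n m} → Cmd n (suc m) → Tm n m

    data Cmd : ℕ → ℕ → Set where
      named : ∀ {n m} → Fin m → Tm n m → Cmd n m

  mutual
    renT : ∀ {n n' m} → Ren n n' → Tm n m → Tm n' m
    renT ρ (var i)   = var (ρ i)
    renT ρ (lam t)   = lam (renT (lift ρ) t)
    renT ρ (app t u) = app (renT ρ t) (renT ρ u)
    renT ρ (mu c)    = mu (renTC ρ c)

    renTC : ∀ {n n' m} → Ren n n' → Cmd n m → Cmd n' m
    renTC ρ (named α t) = named α (renT ρ t)

  mutual
    renN : ∀ {n m m'} → Ren m m' → Tm n m → Tm n m'
    renN ρ (var i)   = var i
    renN ρ (lam t)   = lam (renN ρ t)
    renN ρ (app t u) = app (renN ρ t) (renN ρ u)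
    renN ρ (mu c)    = mu (renNC (lift ρ) c)

    renNC : ∀ {n m m'} → Ren m m' → Cmd n m → Cmd n m'
    renNC ρ (named α t) = named (ρ α) (renN ρ t)

  Sub : ℕ → ℕ → ℕ → Set
  Sub n n' m = Fin n → Tm n' m

  liftS : ∀ {n n' m} → Sub n n' m → Sub (suc n) (suc n') m
  liftS σ zero    = var zero
  liftS σ (suc i) = renT suc (σ i)

  liftSN : ∀ {n n' m} → Sub n n' m → Sub n n' (suc m)
  liftSN σ i = renN suc (σ i)

  mutual
    sub : ∀ {n n' m} → Sub n n' m → Tm n m → Tm n' m
    sub σ (var i)   = σ i
    sub σ (lam t)   = lam (sub (liftS σ) t)
    sub σ (app t u) = app (sub σ t) (sub σ u)
    sub σ (mu c)    = mu (subC (liftSN σ) c)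

    subC : ∀ {n n' m} → Sub n n' m → Cmd n m → Cmd n' m
    subC σ (named α t) = named α (sub σ t)

  sub0 : ∀ {n m} → Tm n m → Sub (suc n) n m
  sub0 u zero    = u
  sub0 u (suc i) = var i

  _[0≔_] : ∀ {n m} → Tm (suc n) m → Tm n m → Tm n m
  t [0≔ u ] = sub (sub0 u) t

  -- With ρ = identity this is o{α//u}; with ρ
  -- sending α to γ (and being the identity elsewhere) it is o{α//γ.u}.
  mutual
    rep : ∀ {n m m'} → Ren m m' → Fin m → Tm n m' → Tm n m → Tm n m'
    rep ρ α u (var i)   = var i
    rep ρ α u (lam t)   = lam (rep ρ α (renT suc u) t)
    rep ρ α u (app t s) = app (rep ρ α u t) (rep ρ α u s)
    rep ρ α u (mu c)    = mu (repC (lift ρ) (suc α) (renN suc u) c)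

    repC : ∀ {n m m'} → Ren m m' → Fin m → Tm n m' → Cmd n m → Cmd n m'
    repC ρ α u (named β t) with β ≟ α
    ... | yes _ = named (ρ β) (app (rep ρ α u t) u)
    ... | no  _ = named (ρ β) (rep ρ α u t)

  replace0 : ∀ {n m} → Cmd n (suc m) → Tm n (suc m) → Cmd n (suc m)
  replace0 c u = repC idR zero u c

  shiftTo : ∀ {m} → Fin m → Ren (suc m) m
  shiftTo γ zero    = γ
  shiftTo γ (suc i) = i

  freshReplace0 : ∀ {n m} → Cmd n (suc m) → Fin m → Tm n m → Cmd n m
  freshReplace0 c γ u = repC (shiftTo γ) zero u c

  mutual
    data _⟶_ : ∀ {n m} → Tm n m → Tm n m → Set where
      β    : ∀ {n m} {t : Tm (suc n) m} {u : Tm n m} →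
             app (lam t) u ⟶ (t [0≔ u ])
      μ    : ∀ {n m} {c : Cmd n (suc m)} {u : Tm n m} →
             app (mu c) u ⟶ mu (replace0 c (renN suc u))
      lamC : ∀ {n m} {t t' : Tm (suc n) m} → t ⟶ t' → lam t ⟶ lam t'
      appL : ∀ {n m} {t t' u : Tm n m} → t ⟶ t' → app t u ⟶ app t' u
      appR : ∀ {n m} {t u u' : Tm n m} → u ⟶ u' → app t u ⟶ app t u'
      muC  : ∀ {n m} {c c' : Cmd n (suc m)} → c ⟶c c' → mu c ⟶ mu c'

    data _⟶c_ : ∀ {n m} → Cmd n m → Cmd n m → Set where
      namedC : ∀ {n m} {α : Fin m} {t t' : Tm n m} → t ⟶ t' → named α t ⟶c named α t'

  _⟶*_ : ∀ {n m} → Tm n m → Tm n m → Set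
  _⟶*_ = Star _⟶_

  _⟶c*_ : ∀ {n m} → Cmd n m → Cmd n m → Set
  _⟶c*_ = Star _⟶c_

module LMS where

  mutual
    data Tm : ℕ → ℕ → Set where
      var  : ∀ {n m} → Fin n → Tm n m
      lam  : ∀ {n m} → Tm (suc n) m → Tm n m
      app  : ∀ {n m} → Tm n m → Tm n m → Tm n m
      mu   : ∀ {n m} → Cmd n (suc m) → Tm n m
      esub : ∀ {n m} → Tm (suc n) m → Tm n m → Tm n m

    data Cmd : ℕ → ℕ → Set where
      named : ∀ {n m} → Fin m → Tm n m → Cmd n m
      -- c⟨α//β.u⟩ : α = index 0 of c (bound), β a name outside
      erep  : ∀ {n m} → Cmd n (suc m) → Fin m → Tm n m → Cmd n m

  mutual
    renT : ∀ {n n' m} → Ren n n' → Tm n m → Tm n' m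
    renT ρ (var i)    = var (ρ i)
    renT ρ (lam t)    = lam (renT (lift ρ) t)
    renT ρ (app t u)  = app (renT ρ t) (renT ρ u)
    renT ρ (mu c)     = mu (renTC ρ c)
    renT ρ (esub t u) = esub (renT (lift ρ) t) (renT ρ u)

    renTC : ∀ {n n' m} → Ren n n' → Cmd n m → Cmd n' m
    renTC ρ (named α t)  = named α (renT ρ t)
    renTC ρ (erep c β u) = erep (renTC ρ c) β (renT ρ u)

  mutual
    renN : ∀ {n m m'} → Ren m m' → Tm n m → Tm n m'
    renN ρ (var i)    = var i
    renN ρ (lam t)    = lam (renN ρ t)
    renN ρ (app t u)  = app (renN ρ t) (renN ρ u)
    renN ρ (mu c)     = mu (renNC (lift ρ) c)
    renN ρ (esub t u) = esub (renN ρ t) (renN ρ u)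

    renNC : ∀ {n m m'} → Ren m m' → Cmd n m → Cmd n m'
    renNC ρ (named α t)  = named (ρ α) (renN ρ t)
    renNC ρ (erep c β u) = erep (renNC (lift ρ) c) (ρ β) (renN ρ u)

  eqCount : ∀ {k} → Fin k → Fin k → ℕ
  eqCount i j with i ≟ j
  ... | yes _ = 1
  ... | no  _ = 0

  mutual
    cnt : ∀ {n m} → Fin n → Tm n m → ℕ
    cnt x (var i)    = eqCount i x
    cnt x (lam t)    = cnt (suc x) t
    cnt x (app t u)  = cnt x t + cnt x u
    cnt x (mu c)     = cntC x c
    cnt x (esub t u) = cnt (suc x) t + cnt x u

    cntC : ∀ {n m} → Fin n → Cmd n m → ℕ
    cntC x (named α t)  = cnt x t
    cntC x (erep c β u) = cntC x c + cnt x u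

  mutual
    cntN : ∀ {n m} → Fin m → Tm n m → ℕ
    cntN α (var i)    = 0
    cntN α (lam t)    = cntN α t
    cntN α (app t u)  = cntN α t + cntN α u
    cntN α (mu c)     = cntNC (suc α) c
    cntN α (esub t u) = cntN α t + cntN α u

    cntNC : ∀ {n m} → Fin m → Cmd n m → ℕ
    cntNC α (named β t)  = eqCount β α + cntN α t
    cntNC α (erep c β u) = cntNC (suc α) c + eqCount β α + cntN α u

  -- substitution contexts L ::= □ | L[x/u]
  -- LC n m k : the whole term has scope n, the hole has scope k.
  data LC : ℕ → ℕ → ℕ → Set where
    hole : ∀ {n m} → LC n m n
    _[/_] : ∀ {n m k} → LC (suc n) m k → Tm n m → LC n m k

  plugL : ∀ {n m k} → LC n m k → Tm k m → Tm n m
  plugL hole      t = t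
  plugL (L [/ u ]) t = esub (plugL L t) u

  -- moving a term from outside L to the scope of its hole (no capture)
  wkL : ∀ {n m k} → LC n m k → Tm n m → Tm k m
  wkL hole      u = u
  wkL (L [/ v ]) u = wkL L (renT suc u)

  -- Hit x u t t' : t = TT[x] and t' = TT[u] for a context TT (grammar
  -- TT / CT) not binding x; x and u are shifted when passing binders.
  mutual
    data Hit : ∀ {n m} → Fin n → Tm n m → Tm n m → Tm n m → Set where
      here  : ∀ {n m} {x : Fin n} {u : Tm n m} → Hit x u (var x) u
      lamH  : ∀ {n m} {x : Fin n} {u : Tm n m} {t t'} →
              Hit (suc x) (renT suc u) t t' → Hit x u (lam t) (lam t')
      appL  : ∀ {n m} {x : Fin n} {u : Tm n m} {t t' s} →
              Hit x u t t' → Hit x u (app t s) (app t' s)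
      appR  : ∀ {n m} {x : Fin n} {u : Tm n m} {t s s'} →
              Hit x u s s' → Hit x u (app t s) (app t s')
      muH   : ∀ {n m} {x : Fin n} {u : Tm n m} {c c'} →
              HitC x (renN suc u) c c' → Hit x u (mu c) (mu c')
      esubL : ∀ {n m} {x : Fin n} {u : Tm n m} {t t' s} →
              Hit (suc x) (renT suc u) t t' → Hit x u (esub t s) (esub t' s)
      esubR : ∀ {n m} {x : Fin n} {u : Tm n m} {t s s'} →
              Hit x u s s' → Hit x u (esub t s) (esub t s')

    data HitC : ∀ {n m} → Fin n → Tm n m → Cmd n m → Cmd n m → Set where
      namedH : ∀ {n m} {x : Fin n} {u : Tm n m} {α t t'} →
               Hit x u t t' → HitC x u (named α t) (named α t')
      erepL  : ∀ {n m} {x : Fin n} {u : Tm n m} {c c' β s} →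
               HitC x (renN suc u) c c' → HitC x u (erep c β s) (erep c' β s)
      erepR  : ∀ {n m} {x : Fin n} {u : Tm n m} {c β s s'} →
               Hit x u s s' → HitC x u (erep c β s) (erep c β s')

  -- NHitC α γ u c c' : c = CC[[α]t] and c' = CC[[γ](t u)] for a context CC
  -- (grammar CC / TC) not binding α, γ; α, γ, u shifted under binders.
  mutual
    data NHitC : ∀ {n m} → Fin m → Fin m → Tm n m → Cmd n m → Cmd n m → Set where
      here   : ∀ {n m} {α γ : Fin m} {u : Tm n m} {t} →
               NHitC α γ u (named α t) (named γ (app t u))
      namedH : ∀ {n m} {α γ : Fin m} {u : Tm n m} {β t t'} →
               NHit α γ u t t' → NHitC α γ u (named β t) (named β t')
      erepL  : ∀ {n m} {α γ : Fin m} {u : Tm n m} {c c' β s} →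
               NHitC (suc α) (suc γ) (renN suc u) c c' →
               NHitC α γ u (erep c β s) (erep c' β s)
      erepR  : ∀ {n m} {α γ : Fin m} {u : Tm n m} {c β s s'} →
               NHit α γ u s s' → NHitC α γ u (erep c β s) (erep c β s')

    data NHit : ∀ {n m} → Fin m → Fin m → Tm n m → Tm n m → Tm n m → Set where
      lamH  : ∀ {n m} {α γ : Fin m} {u : Tm n m} {t t'} →
              NHit α γ (renT suc u) t t' → NHit α γ u (lam t) (lam t')
      appL  : ∀ {n m} {α γ : Fin m} {u : Tm n m} {t t' s} →
              NHit α γ u t t' → NHit α γ u (app t s) (app t' s)
      appR  : ∀ {n m} {α γ : Fin m} {u : Tm n m} {t s s'} →
              NHit α γ u s s' → NHit α γ u (app t s) (app t s')
      muH   : ∀ {n m} {α γ : Fin m} {u : Tm n m} {c c'} →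
              NHitC (suc α) (suc γ) (renN suc u) c c' → NHit α γ u (mu c) (mu c')
      esubL : ∀ {n m} {α γ : Fin m} {u : Tm n m} {t t' s} →
              NHit α γ (renT suc u) t t' → NHit α γ u (esub t s) (esub t' s)
      esubR : ∀ {n m} {α γ : Fin m} {u : Tm n m} {t s s'} →
              NHit α γ u s s' → NHit α γ u (esub t s) (esub t s')

  mutual
    data _⟶_ : ∀ {n m} → Tm n m → Tm n m → Set where
      dB    : ∀ {n m k} (L : LC n m k) {t : Tm (suc k) m} {u : Tm n m} →
              app (plugL L (lam t)) u ⟶ plugL L (esub t (wkL L u))
      -- TT[x][x/u] → TT[u][x/u]   if |TT[x]|_x > 1
      sDup  : ∀ {n m} {t t' : Tm (suc n) m} {u : Tm n m} →
              Hit zero (renT suc u) t t' → cnt zero t > 1 →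
              esub t u ⟶ esub t' u
      -- TT[x][x/u] → TT[u]        if |TT[x]|_x = 1
      -- (TT[u] no longer mentions x, i.e. it is the weakening of some t'')
      sLin  : ∀ {n m} {t : Tm (suc n) m} {u : Tm n m} (t'' : Tm n m) →
              Hit zero (renT suc u) t (renT suc t'') → cnt zero t ≡ 1 →
              esub t u ⟶ t''
      -- t[x/u] → t               if x ∉ fv(t)
      sGc   : ∀ {n m} {t : Tm n m} {u : Tm n m} →
              esub (renT suc t) u ⟶ t
      -- L[μα.c] u → L[μγ.c⟨α//γ.u⟩]   (γ fresh)
      dM    : ∀ {n m k} (L : LC n m k) {c : Cmd k (suc m)} {u : Tm n m} →
              app (plugL L (mu c)) u ⟶
              plugL L (mu (erep (renNC (lift suc) c) zero (renN suc (wkL L u))))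
      lamC  : ∀ {n m} {t t' : Tm (suc n) m} → t ⟶ t' → lam t ⟶ lam t'
      appL  : ∀ {n m} {t t' u : Tm n m} → t ⟶ t' → app t u ⟶ app t' u
      appR  : ∀ {n m} {t u u' : Tm n m} → u ⟶ u' → app t u ⟶ app t u'
      muC   : ∀ {n m} {c c' : Cmd n (suc m)} → c ⟶c c' → mu c ⟶ mu c'
      esubL : ∀ {n m} {t t' : Tm (suc n) m} {u : Tm n m} → t ⟶ t' → esub t u ⟶ esub t' u
      esubR : ∀ {n m} {t : Tm (suc n) m} {u u' : Tm n m} → u ⟶ u' → esub t u ⟶ esub t u'

    data _⟶c_ : ∀ {n m} → Cmd n m → Cmd n m → Set where
      -- CC[[α]t]⟨α//γ.u⟩ → CC[[γ]t u]⟨α//γ.u⟩   if |CC[[α]t]|_α > 1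
      rDup   : ∀ {n m} {c c' : Cmd n (suc m)} {γ : Fin m} {u : Tm n m} →
               NHitC zero (suc γ) (renN suc u) c c' → cntNC zero c > 1 →
               erep c γ u ⟶c erep c' γ u
      -- CC[[α]t]⟨α//γ.u⟩ → CC[[γ]t u]            if |CC[[α]t]|_α = 1
      rLin   : ∀ {n m} {c : Cmd n (suc m)} {γ : Fin m} {u : Tm n m} (c'' : Cmd n m) →
               NHitC zero (suc γ) (renN suc u) c (renNC suc c'') → cntNC zero c ≡ 1 →
               erep c γ u ⟶c c''
      -- c⟨α//γ.u⟩ → c                             if α ∉ fn(c)
      rGc    : ∀ {n m} {c : Cmd n m} {γ : Fin m} {u : Tm n m} →
               erep (renNC suc c) γ u ⟶c c
      namedC : ∀ {n m} {α : Fin m} {t t' : Tm n m} → t ⟶ t' → named α t ⟶c named α t'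
      erepL  : ∀ {n m} {c c' : Cmd n (suc m)} {β : Fin m} {u : Tm n m} →
               c ⟶c c' → erep c β u ⟶c erep c' β u
      erepR  : ∀ {n m} {c : Cmd n (suc m)} {β : Fin m} {u u' : Tm n m} →
               u ⟶ u' → erep c β u ⟶c erep c β u'

mutual
  ↓ : ∀ {n m} → LMS.Tm n m → LM.Tm n m
  ↓ (LMS.var i)    = LM.var i
  ↓ (LMS.lam t)    = LM.lam (↓ t)
  ↓ (LMS.app t u)  = LM.app (↓ t) (↓ u)
  ↓ (LMS.mu c)     = LM.mu (↓c c)
  ↓ (LMS.esub t u) = LM._[0≔_] (↓ t) (↓ u)

  ↓c : ∀ {n m} → LMS.Cmd n m → LM.Cmd n m
  ↓c (LMS.named α t)  = LM.named α (↓ t)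
  ↓c (LMS.erep c β u) = LM.freshReplace0 (↓c c) β (↓ u)

module Submission where

-- Everything rests on a single generalised operation on λμ-objects, the
-- action  act E  of an environment E: it simultaneously substitutes terms
-- for variables, renames names, and turns every command [β]t into
-- [ρ β](t a₁ … aₖ), where a₁ … aₖ is the list of arguments E attaches to β.
-- Renaming, substitution t{x/u}, replacement c{α//u} and fresh replacement
-- c{α//γ.u} are all instances, and environments compose (act-⊙).
-- The duplication, linear and garbage rules therefore project to
-- equalities, dB and dM project to one β- resp. μ-step, and the
-- congruence rules follow from monotonicity of act.

open import Defs
open import Data.Product using (_×_; _,_)
open import Data.Nat using (ℕ; zero; suc)
open import Data.Fin using (Fin; zero; suc; _≟_)
open import Data.List using (List; []; _∷_; map; _++_)
open import Data.List.Properties using (map-∘; map-cong; map-id; map-++; ++-identityʳ)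
open import Data.List.Relation.Binary.Pointwise as Pointwise using (Pointwise; []; _∷_)
open import Relation.Nullary using (yes; no)
open import Relation.Binary.PropositionalEquality
open import Relation.Binary.Construct.Closure.ReflexiveTransitive using (ε; _◅_; _◅◅_; gmap)

open LM
open ≡-Reasoning

private variable
  n m n' m' n₁ m₁ n₂ m₂ k : ℕ

map-fuse : ∀ {A B C : Set} {f : B → C} {g : A → B} {h : A → C} →
           (∀ x → f (g x) ≡ h x) → ∀ xs → map f (map g xs) ≡ map h xs
map-fuse e xs = trans (sym (map-∘ xs)) (map-cong e xs)

map-square : ∀ {A B C D : Set} {f : B → C} {g : A → B} {g' : D → C} {f' : A → D} →
             (∀ x → f (g x) ≡ g' (f' x)) → ∀ xs → map f (map g xs) ≡ map g' (map f' xs)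
map-square e xs = trans (map-fuse e xs) (map-∘ xs)

mutual
  renT-∘ : {ρ : Ren n₁ n₂} {ρ' : Ren n n₁} {ρ'' : Ren n n₂} →
           (∀ i → ρ (ρ' i) ≡ ρ'' i) → (t : Tm n m) → renT ρ (renT ρ' t) ≡ renT ρ'' t
  renT-∘ h (var i)   = cong var (h i)
  renT-∘ h (lam t)   = cong lam (renT-∘ (λ { zero → refl ; (suc i) → cong suc (h i) }) t)
  renT-∘ h (app t u) = cong₂ app (renT-∘ h t) (renT-∘ h u)
  renT-∘ h (mu c)    = cong mu (renTC-∘ h c)

  renTC-∘ : {ρ : Ren n₁ n₂} {ρ' : Ren n n₁} {ρ'' : Ren n n₂} →
            (∀ i → ρ (ρ' i) ≡ ρ'' i) → (c : Cmd n m) → renTC ρ (renTC ρ' c) ≡ renTC ρ'' c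
  renTC-∘ h (named α t) = cong (named α) (renT-∘ h t)

mutual
  renN-∘ : {ρ : Ren m₁ m₂} {ρ' : Ren m m₁} {ρ'' : Ren m m₂} →
           (∀ i → ρ (ρ' i) ≡ ρ'' i) → (t : Tm n m) → renN ρ (renN ρ' t) ≡ renN ρ'' t
  renN-∘ h (var i)   = refl
  renN-∘ h (lam t)   = cong lam (renN-∘ h t)
  renN-∘ h (app t u) = cong₂ app (renN-∘ h t) (renN-∘ h u)
  renN-∘ h (mu c)    = cong mu (renNC-∘ (λ { zero → refl ; (suc i) → cong suc (h i) }) c)

  renNC-∘ : {ρ : Ren m₁ m₂} {ρ' : Ren m m₁} {ρ'' : Ren m m₂} →
            (∀ i → ρ (ρ' i) ≡ ρ'' i) → (c : Cmd n m) → renNC ρ (renNC ρ' c) ≡ renNC ρ'' c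
  renNC-∘ h (named α t) = cong₂ named (h α) (renN-∘ h t)

renT-lift-suc : (ρ : Ren n n') (t : Tm n m) → renT (lift ρ) (renT suc t) ≡ renT suc (renT ρ t)
renT-lift-suc ρ t = trans (renT-∘ (λ _ → refl) t) (sym (renT-∘ (λ _ → refl) t))

renN-lift-suc : (ρ : Ren m m') (t : Tm n m) → renN (lift ρ) (renN suc t) ≡ renN suc (renN ρ t)
renN-lift-suc ρ t = trans (renN-∘ (λ _ → refl) t) (sym (renN-∘ (λ _ → refl) t))

mutual
  renT-renN : (ρ : Ren n n') (ρ' : Ren m m') (t : Tm n m) → renT ρ (renN ρ' t) ≡ renN ρ' (renT ρ t)
  renT-renN ρ ρ' (var i)   = refl
  renT-renN ρ ρ' (lam t)   = cong lam (renT-renN (lift ρ) ρ' t)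
  renT-renN ρ ρ' (app t u) = cong₂ app (renT-renN ρ ρ' t) (renT-renN ρ ρ' u)
  renT-renN ρ ρ' (mu c)    = cong mu (renTC-renNC ρ (lift ρ') c)

  renTC-renNC : (ρ : Ren n n') (ρ' : Ren m m') (c : Cmd n m) → renTC ρ (renNC ρ' c) ≡ renNC ρ' (renTC ρ c)
  renTC-renNC ρ ρ' (named α t) = cong (named (ρ' α)) (renT-renN ρ ρ' t)

apps : Tm n m → List (Tm n m) → Tm n m
apps t []       = t
apps t (a ∷ as) = apps (app t a) as

apps-++ : (t : Tm n m) (as bs : List (Tm n m)) → apps t (as ++ bs) ≡ apps (apps t as) bs
apps-++ t []       bs = refl
apps-++ t (a ∷ as) bs = apps-++ (app t a) as bs

renT-apps : (ρ : Ren n n') (t : Tm n m) (as : List (Tm n m)) → renT ρ (apps t as) ≡ apps (renT ρ t) (map (renT ρ) as)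
renT-apps ρ t []       = refl
renT-apps ρ t (a ∷ as) = renT-apps ρ (app t a) as

renN-apps : (ρ : Ren m m') (t : Tm n m) (as : List (Tm n m)) → renN ρ (apps t as) ≡ apps (renN ρ t) (map (renN ρ) as)
renN-apps ρ t []       = refl
renN-apps ρ t (a ∷ as) = renN-apps ρ (app t a) as

record Env (n m n' m' : ℕ) : Set where
  constructor env
  field
    vars  : Fin n → Tm n' m'
    names : Ren m m'
    args  : Fin m → List (Tm n' m')
open Env public

underλ : Env n m n' m' → Env (suc n) m (suc n') m'
underλ E = env (liftS (vars E)) (names E) (λ b → map (renT suc) (args E b))

argsUnderμ : (Fin m → List (Tm n' m')) → Fin (suc m) → List (Tm n' (suc m'))
argsUnderμ a zero    = []
argsUnderμ a (suc b) = map (renN suc) (a b)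

underμ : Env n m n' m' → Env n (suc m) n' (suc m')
underμ E = env (liftSN (vars E)) (lift (names E)) (argsUnderμ (args E))

mutual
  act : Env n m n' m' → Tm n m → Tm n' m'
  act E (var i)   = vars E i
  act E (lam t)   = lam (act (underλ E) t)
  act E (app t u) = app (act E t) (act E u)
  act E (mu c)    = mu (actC (underμ E) c)

  actC : Env n m n' m' → Cmd n m → Cmd n' m'
  actC E (named b t) = named (names E b) (apps (act E t) (args E b))

act-apps : (E : Env n m n' m') (t : Tm n m) (as : List (Tm n m)) → act E (apps t as) ≡ apps (act E t) (map (act E) as)
act-apps E t []       = refl
act-apps E t (a ∷ as) = act-apps E (app t a) as

record _≈E_ (E E' : Env n m n' m') : Set where
  constructor ≈env
  field
    ≈vars  : ∀ i → vars E i ≡ vars E' i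
    ≈names : ∀ b → names E b ≡ names E' b
    ≈args  : ∀ b → args E b ≡ args E' b
open _≈E_

underλ-cong : {E E' : Env n m n' m'} → E ≈E E' → underλ E ≈E underλ E'
underλ-cong q = ≈env (λ { zero → refl ; (suc i) → cong (renT suc) (≈vars q i) })
                     (≈names q) (λ b → cong (map (renT suc)) (≈args q b))

underμ-cong : {E E' : Env n m n' m'} → E ≈E E' → underμ E ≈E underμ E'
underμ-cong q = ≈env (λ i → cong (renN suc) (≈vars q i))
                     (λ { zero → refl ; (suc b) → cong suc (≈names q b) })
                     (λ { zero → refl ; (suc b) → cong (map (renN suc)) (≈args q b) })

mutual
  act-cong : {E E' : Env n m n' m'} → E ≈E E' → (t : Tm n m) → act E t ≡ act E' t
  act-cong q (var i)   = ≈vars q i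
  act-cong q (lam t)   = cong lam (act-cong (underλ-cong q) t)
  act-cong q (app t u) = cong₂ app (act-cong q t) (act-cong q u)
  act-cong q (mu c)    = cong mu (actC-cong (underμ-cong q) c)

  actC-cong : {E E' : Env n m n' m'} → E ≈E E' → (c : Cmd n m) → actC E c ≡ actC E' c
  actC-cong q (named b t) = cong₂ named (≈names q b) (cong₂ apps (act-cong q t) (≈args q b))

_∘ᵛ_ : Env n₁ m n' m' → Ren n n₁ → Env n m n' m'
E ∘ᵛ ρ = env (λ i → vars E (ρ i)) (names E) (args E)

_∘ⁿ_ : Env n m₁ n' m' → Ren m m₁ → Env n m n' m'
E ∘ⁿ ρ = env (vars E) (λ b → names E (ρ b)) (λ b → args E (ρ b))

_ᵛ∘_ : Ren n' n₂ → Env n m n' m' → Env n m n₂ m'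
ρ ᵛ∘ E = env (λ i → renT ρ (vars E i)) (names E) (λ b → map (renT ρ) (args E b))

_ⁿ∘_ : Ren m' m₂ → Env n m n' m' → Env n m n' m₂
ρ ⁿ∘ E = env (λ i → renN ρ (vars E i)) (λ b → ρ (names E b)) (λ b → map (renN ρ) (args E b))

mutual
  act-renT : (E : Env n₁ m n' m') (ρ : Ren n n₁) (t : Tm n m) → act E (renT ρ t) ≡ act (E ∘ᵛ ρ) t
  act-renT E ρ (var i)   = refl
  act-renT E ρ (lam t)   = cong lam (trans (act-renT (underλ E) (lift ρ) t)
    (act-cong (≈env (λ { zero → refl ; (suc i) → refl }) (λ _ → refl) (λ _ → refl)) t))
  act-renT E ρ (app t u) = cong₂ app (act-renT E ρ t) (act-renT E ρ u)
  act-renT E ρ (mu c)    = cong mu (actC-renTC (underμ E) ρ c)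

  actC-renTC : (E : Env n₁ m n' m') (ρ : Ren n n₁) (c : Cmd n m) → actC E (renTC ρ c) ≡ actC (E ∘ᵛ ρ) c
  actC-renTC E ρ (named b t) = cong (λ z → named (names E b) (apps z (args E b))) (act-renT E ρ t)

mutual
  act-renN : (E : Env n m₁ n' m') (ρ : Ren m m₁) (t : Tm n m) → act E (renN ρ t) ≡ act (E ∘ⁿ ρ) t
  act-renN E ρ (var i)   = refl
  act-renN E ρ (lam t)   = cong lam (act-renN (underλ E) ρ t)
  act-renN E ρ (app t u) = cong₂ app (act-renN E ρ t) (act-renN E ρ u)
  act-renN E ρ (mu c)    = cong mu (trans (actC-renNC (underμ E) (lift ρ) c)
    (actC-cong (≈env (λ _ → refl) (λ { zero → refl ; (suc b) → refl })
                                  (λ { zero → refl ; (suc b) → refl })) c))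

  actC-renNC : (E : Env n m₁ n' m') (ρ : Ren m m₁) (c : Cmd n m) → actC E (renNC ρ c) ≡ actC (E ∘ⁿ ρ) c
  actC-renNC E ρ (named b t) = cong (λ z → named (names E (ρ b)) (apps z (args E (ρ b)))) (act-renN E ρ t)

mutual
  renT-act : (ρ : Ren n' n₂) (E : Env n m n' m') (t : Tm n m) → renT ρ (act E t) ≡ act (ρ ᵛ∘ E) t
  renT-act ρ E (var i)   = refl
  renT-act ρ E (lam t)   = cong lam (trans (renT-act (lift ρ) (underλ E) t)
    (act-cong (≈env (λ { zero → refl ; (suc i) → renT-lift-suc ρ (vars E i) }) (λ _ → refl)
                    (λ b → map-square (renT-lift-suc ρ) (args E b))) t))
  renT-act ρ E (app t u) = cong₂ app (renT-act ρ E t) (renT-act ρ E u)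
  renT-act ρ E (mu c)    = cong mu (trans (renTC-actC ρ (underμ E) c)
    (actC-cong (≈env (λ i → renT-renN ρ suc (vars E i)) (λ _ → refl)
                     (λ { zero → refl ; (suc b) → map-square (renT-renN ρ suc) (args E b) })) c))

  renTC-actC : (ρ : Ren n' n₂) (E : Env n m n' m') (c : Cmd n m) → renTC ρ (actC E c) ≡ actC (ρ ᵛ∘ E) c
  renTC-actC ρ E (named b t) = cong (named (names E b))
    (trans (renT-apps ρ (act E t) (args E b)) (cong (λ z → apps z (map (renT ρ) (args E b))) (renT-act ρ E t)))

mutual
  renN-act : (ρ : Ren m' m₂) (E : Env n m n' m') (t : Tm n m) → renN ρ (act E t) ≡ act (ρ ⁿ∘ E) t
  renN-act ρ E (var i)   = refl
  renN-act ρ E (lam t)   = cong lam (trans (renN-act ρ (underλ E) t)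
    (act-cong (≈env (λ { zero → refl ; (suc i) → sym (renT-renN suc ρ (vars E i)) }) (λ _ → refl)
                    (λ b → map-square (λ x → sym (renT-renN suc ρ x)) (args E b))) t))
  renN-act ρ E (app t u) = cong₂ app (renN-act ρ E t) (renN-act ρ E u)
  renN-act ρ E (mu c)    = cong mu (trans (renNC-actC (lift ρ) (underμ E) c)
    (actC-cong (≈env (λ i → renN-lift-suc ρ (vars E i)) (λ { zero → refl ; (suc b) → refl })
                     (λ { zero → refl ; (suc b) → map-square (renN-lift-suc ρ) (args E b) })) c))

  renNC-actC : (ρ : Ren m' m₂) (E : Env n m n' m') (c : Cmd n m) → renNC ρ (actC E c) ≡ actC (ρ ⁿ∘ E) c
  renNC-actC ρ E (named b t) = cong (named (ρ (names E b)))
    (trans (renN-apps ρ (act E t) (args E b)) (cong (λ z → apps z (map (renN ρ) (args E b))) (renN-act ρ E t)))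

act-weakenT : (E : Env n m n' m') (t : Tm n m) → act (underλ E) (renT suc t) ≡ renT suc (act E t)
act-weakenT E t = trans (act-renT (underλ E) suc t) (sym (renT-act suc E t))

act-weakenN : (E : Env n m n' m') (t : Tm n m) → act (underμ E) (renN suc t) ≡ renN suc (act E t)
act-weakenN E t = trans (act-renN (underμ E) suc t) (sym (renN-act suc E t))

_⊙_ : Env n₁ m₁ n₂ m₂ → Env n m n₁ m₁ → Env n m n₂ m₂
E₁ ⊙ E₂ = env (λ i → act E₁ (vars E₂ i)) (λ b → names E₁ (names E₂ b))
              (λ b → map (act E₁) (args E₂ b) ++ args E₁ (names E₂ b))

mutual
  act-⊙ : (E₁ : Env n₁ m₁ n₂ m₂) (E₂ : Env n m n₁ m₁) (t : Tm n m) → act E₁ (act E₂ t) ≡ act (E₁ ⊙ E₂) t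
  act-⊙ E₁ E₂ (var i)   = refl
  act-⊙ E₁ E₂ (lam t)   = cong lam (trans (act-⊙ (underλ E₁) (underλ E₂) t)
    (act-cong (≈env (λ { zero → refl ; (suc i) → act-weakenT E₁ (vars E₂ i) }) (λ _ → refl)
      (λ b → trans (cong (_++ _) (map-square (act-weakenT E₁) (args E₂ b)))
                   (sym (map-++ (renT suc) (map (act E₁) (args E₂ b)) (args E₁ (names E₂ b)))))) t))
  act-⊙ E₁ E₂ (app t u) = cong₂ app (act-⊙ E₁ E₂ t) (act-⊙ E₁ E₂ u)
  act-⊙ E₁ E₂ (mu c)    = cong mu (trans (actC-⊙ (underμ E₁) (underμ E₂) c)
    (actC-cong (≈env (λ i → act-weakenN E₁ (vars E₂ i)) (λ { zero → refl ; (suc b) → refl })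
      (λ { zero → refl
         ; (suc b) → trans (cong (_++ _) (map-square (act-weakenN E₁) (args E₂ b)))
                           (sym (map-++ (renN suc) (map (act E₁) (args E₂ b)) (args E₁ (names E₂ b)))) })) c))

  actC-⊙ : (E₁ : Env n₁ m₁ n₂ m₂) (E₂ : Env n m n₁ m₁) (c : Cmd n m) → actC E₁ (actC E₂ c) ≡ actC (E₁ ⊙ E₂) c
  actC-⊙ E₁ E₂ (named b t) = cong (named (names E₁ (names E₂ b))) (begin
    apps (act E₁ (apps (act E₂ t) as₂)) as₁
      ≡⟨ cong (λ z → apps z as₁) (act-apps E₁ (act E₂ t) as₂) ⟩
    apps (apps (act E₁ (act E₂ t)) (map (act E₁) as₂)) as₁
      ≡⟨ sym (apps-++ _ (map (act E₁) as₂) as₁) ⟩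
    apps (act E₁ (act E₂ t)) (map (act E₁) as₂ ++ as₁)
      ≡⟨ cong (λ z → apps z (map (act E₁) as₂ ++ as₁)) (act-⊙ E₁ E₂ t) ⟩
    apps (act (E₁ ⊙ E₂) t) (map (act E₁) as₂ ++ as₁)
      ∎)
    where
    as₁ = args E₁ (names E₂ b)
    as₂ = args E₂ b

record IsId (E : Env n m n m) : Set where
  constructor isId
  field
    id-vars  : ∀ i → vars E i ≡ var i
    id-names : ∀ b → names E b ≡ b
    id-args  : ∀ b → args E b ≡ []
open IsId

mutual
  act-id : {E : Env n m n m} → IsId E → (t : Tm n m) → act E t ≡ t
  act-id q (var i)   = id-vars q i
  act-id q (lam t)   = cong lam (act-id (isId (λ { zero → refl ; (suc i) → cong (renT suc) (id-vars q i) })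
                                                (id-names q) (λ b → cong (map (renT suc)) (id-args q b))) t)
  act-id q (app t u) = cong₂ app (act-id q t) (act-id q u)
  act-id q (mu c)    = cong mu (actC-id (isId (λ i → cong (renN suc) (id-vars q i))
                                              (λ { zero → refl ; (suc b) → cong suc (id-names q b) })
                                              (λ { zero → refl ; (suc b) → cong (map (renN suc)) (id-args q b) })) c)

  actC-id : {E : Env n m n m} → IsId E → (c : Cmd n m) → actC E c ≡ c
  actC-id q (named b t) = cong₂ named (id-names q b) (cong₂ apps (act-id q t) (id-args q b))

idE : Env n m n m
idE = env var idR (λ _ → [])

idE-isId : IsId (idE {n} {m})
idE-isId = isId (λ _ → refl) (λ _ → refl) (λ _ → refl)

renT-as-act : (ρ : Ren n n') (t : Tm n m) → renT ρ t ≡ act (env (λ i → var (ρ i)) idR (λ _ → [])) t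
renT-as-act ρ t = trans (cong (renT ρ) (sym (act-id idE-isId t))) (renT-act ρ idE t)

renN-as-act : (ρ : Ren m m') (t : Tm n m) → renN ρ t ≡ act (env var ρ (λ _ → [])) t
renN-as-act ρ t = trans (cong (renN ρ) (sym (act-id idE-isId t))) (renN-act ρ idE t)

subE : Sub n n' m → Env n m n' m
subE σ = env σ idR (λ _ → [])

mutual
  sub-as-act : (σ : Sub n n' m) (t : Tm n m) → sub σ t ≡ act (subE σ) t
  sub-as-act σ (var i)   = refl
  sub-as-act σ (lam t)   = cong lam (sub-as-act (liftS σ) t)
  sub-as-act σ (app t u) = cong₂ app (sub-as-act σ t) (sub-as-act σ u)
  sub-as-act σ (mu c)    = cong mu (trans (subC-as-act (liftSN σ) c)
    (actC-cong (≈env (λ _ → refl) (λ { zero → refl ; (suc b) → refl }) (λ { zero → refl ; (suc b) → refl })) c))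

  subC-as-act : (σ : Sub n n' m) (c : Cmd n m) → subC σ c ≡ actC (subE σ) c
  subC-as-act σ (named b t) = cong (named b) (sub-as-act σ t)

argsAt : Fin m → Tm n m' → Fin m → List (Tm n m')
argsAt α u b with b ≟ α
... | yes _ = u ∷ []
... | no  _ = []

argsAt-map : ∀ {n₁ m₁} (f : Tm n m' → Tm n₁ m₁) (α : Fin m) (u : Tm n m') (b : Fin m) →
             argsAt α (f u) b ≡ map f (argsAt α u b)
argsAt-map f α u b with b ≟ α
... | yes _ = refl
... | no  _ = refl

argsAt-suc : ∀ {n₁ m₁} (f : Tm n m' → Tm n₁ m₁) (α : Fin m) (u : Tm n m') (b : Fin m) →
             argsAt (suc α) (f u) (suc b) ≡ map f (argsAt α u b)
argsAt-suc f α u b with b ≟ α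
... | yes _ = refl
... | no  _ = refl

repE : Ren m m' → Fin m → Tm n m' → Env n m n m'
repE ρ α u = env var ρ (argsAt α u)

mutual
  rep-as-act : (ρ : Ren m m') (α : Fin m) (u : Tm n m') (t : Tm n m) → rep ρ α u t ≡ act (repE ρ α u) t
  rep-as-act ρ α u (var i)   = refl
  rep-as-act ρ α u (lam t)   = cong lam (trans (rep-as-act ρ α (renT suc u) t)
    (act-cong (≈env (λ { zero → refl ; (suc i) → refl }) (λ _ → refl) (argsAt-map (renT suc) α u)) t))
  rep-as-act ρ α u (app t s) = cong₂ app (rep-as-act ρ α u t) (rep-as-act ρ α u s)
  rep-as-act ρ α u (mu c)    = cong mu (trans (repC-as-act (lift ρ) (suc α) (renN suc u) c)
    (actC-cong (≈env (λ _ → refl) (λ _ → refl)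
                     (λ { zero → refl ; (suc b) → argsAt-suc (renN suc) α u b })) c))

  repC-as-act : (ρ : Ren m m') (α : Fin m) (u : Tm n m') (c : Cmd n m) → repC ρ α u c ≡ actC (repE ρ α u) c
  repC-as-act ρ α u (named b t) with b ≟ α
  ... | yes _ = cong (λ z → named (ρ b) (app z u)) (rep-as-act ρ α u t)
  ... | no  _ = cong (named (ρ b)) (rep-as-act ρ α u t)

sub0-weakenT : (u : Tm n m) (t : Tm n m) → act (subE (sub0 u)) (renT suc t) ≡ t
sub0-weakenT u t = trans (act-renT (subE (sub0 u)) suc t) (act-id idE-isId t)

replace0-weakenN : (u : Tm n (suc m)) (t : Tm n m) → act (repE idR zero u) (renN suc t) ≡ renN suc t
replace0-weakenN u t = trans (act-renN (repE idR zero u) suc t) (sym (renN-as-act suc t))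

act-β : (E : Env n m n' m') (t : Tm (suc n) m) (u : Tm n m) →
        act (underλ E) t [0≔ act E u ] ≡ act E (t [0≔ u ])
act-β E t u = begin
  sub (sub0 (act E u)) (act (underλ E) t)         ≡⟨ sub-as-act _ (act (underλ E) t) ⟩
  act (subE (sub0 (act E u))) (act (underλ E) t)  ≡⟨ act-⊙ _ (underλ E) t ⟩
  act (subE (sub0 (act E u)) ⊙ underλ E) t        ≡⟨ act-cong same t ⟩
  act (E ⊙ subE (sub0 u)) t                       ≡⟨ sym (act-⊙ E _ t) ⟩
  act E (act (subE (sub0 u)) t)                   ≡⟨ cong (act E) (sym (sub-as-act _ t)) ⟩
  act E (sub (sub0 u) t)                          ∎
  where
  same : (subE (sub0 (act E u)) ⊙ underλ E) ≈E (E ⊙ subE (sub0 u))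
  same = ≈env (λ { zero → refl ; (suc i) → sub0-weakenT (act E u) (vars E i) }) (λ _ → refl)
              (λ b → trans (++-identityʳ _) (trans (map-fuse (sub0-weakenT (act E u)) (args E b)) (map-id (args E b))))

act-μ : (E : Env n m n' m') (c : Cmd n (suc m)) (u : Tm n m) →
        replace0 (actC (underμ E) c) (renN suc (act E u)) ≡ actC (underμ E) (replace0 c (renN suc u))
act-μ E c u = begin
  repC idR zero u' (actC (underμ E) c)     ≡⟨ repC-as-act idR zero u' _ ⟩
  actC R' (actC (underμ E) c)              ≡⟨ actC-⊙ R' (underμ E) c ⟩
  actC (R' ⊙ underμ E) c                   ≡⟨ actC-cong same c ⟩
  actC (underμ E ⊙ R) c                    ≡⟨ sym (actC-⊙ (underμ E) R c) ⟩
  actC (underμ E) (actC R c)               ≡⟨ cong (actC (underμ E)) (sym (repC-as-act idR zero _ c)) ⟩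
  actC (underμ E) (replace0 c (renN suc u)) ∎
  where
  u' = renN suc (act E u)
  R' = repE idR zero u'
  R  = repE idR zero (renN suc u)
  same : (R' ⊙ underμ E) ≈E (underμ E ⊙ R)
  same = ≈env (λ i → replace0-weakenN u' (vars E i)) (λ _ → refl)
              (λ { zero    → cong (_∷ []) (sym (act-weakenN E u))
                 ; (suc b) → trans (++-identityʳ _) (map-fuse (replace0-weakenN u') (args E b)) })

apps-⟶ : {t t' : Tm n m} (as : List (Tm n m)) → t ⟶ t' → apps t as ⟶ apps t' as
apps-⟶ []       r = r
apps-⟶ (a ∷ as) r = apps-⟶ as (appL r)

mutual
  act-⟶ : (E : Env n m n' m') {t t' : Tm n m} → t ⟶ t' → act E t ⟶ act E t'
  act-⟶ E (β {t = t} {u = u}) = subst (app (lam (act (underλ E) t)) (act E u) ⟶_) (act-β E t u) β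
  act-⟶ E (μ {c = c} {u = u}) = subst (app (mu (actC (underμ E) c)) (act E u) ⟶_) (cong mu (act-μ E c u)) μ
  act-⟶ E (lamC r)            = lamC (act-⟶ (underλ E) r)
  act-⟶ E (appL r)            = appL (act-⟶ E r)
  act-⟶ E (appR r)            = appR (act-⟶ E r)
  act-⟶ E (muC r)             = muC (actC-⟶ (underμ E) r)

  actC-⟶ : (E : Env n m n' m') {c c' : Cmd n m} → c ⟶c c' → actC E c ⟶c actC E c'
  actC-⟶ E (namedC {α = b} r) = namedC (apps-⟶ (args E b) (act-⟶ E r))

act-⟶* : (E : Env n m n' m') {t t' : Tm n m} → t ⟶* t' → act E t ⟶* act E t'
act-⟶* E = gmap (act E) (act-⟶ E)

actC-⟶* : (E : Env n m n' m') {c c' : Cmd n m} → c ⟶c* c' → actC E c ⟶c* actC E c'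
actC-⟶* E = gmap (actC E) (actC-⟶ E)

renT-⟶* : (ρ : Ren n n') {t t' : Tm n m} → t ⟶* t' → renT ρ t ⟶* renT ρ t'
renT-⟶* ρ {t} {t'} r = subst₂ _⟶*_ (sym (renT-as-act ρ t)) (sym (renT-as-act ρ t')) (act-⟶* _ r)

renN-⟶* : (ρ : Ren m m') {t t' : Tm n m} → t ⟶* t' → renN ρ t ⟶* renN ρ t'
renN-⟶* ρ {t} {t'} r = subst₂ _⟶*_ (sym (renN-as-act ρ t)) (sym (renN-as-act ρ t')) (act-⟶* _ r)

app-⟶* : {t t' u u' : Tm n m} → t ⟶* t' → u ⟶* u' → app t u ⟶* app t' u'
app-⟶* r s = gmap (λ z → app z _) appL r ◅◅ gmap (app _) appR s

apps-⟶* : {t t' : Tm n m} {as bs : List (Tm n m)} → t ⟶* t' → Pointwise _⟶*_ as bs → apps t as ⟶* apps t' bs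
apps-⟶* r []       = r
apps-⟶* r (s ∷ ss) = apps-⟶* (app-⟶* r s) ss

record _⟶E_ (E E' : Env n m n' m') : Set where
  constructor ⟶env
  field
    ⟶vars  : ∀ i → vars E i ⟶* vars E' i
    ⟶names : ∀ b → names E b ≡ names E' b
    ⟶args  : ∀ b → Pointwise _⟶*_ (args E b) (args E' b)
open _⟶E_

mutual
  act-⟶E : {E E' : Env n m n' m'} → E ⟶E E' → (t : Tm n m) → act E t ⟶* act E' t
  act-⟶E q (var i)   = ⟶vars q i
  act-⟶E q (lam t)   = gmap lam lamC (act-⟶E (⟶env (λ { zero → ε ; (suc i) → renT-⟶* suc (⟶vars q i) })
      (⟶names q) (λ b → Pointwise.map⁺ (renT suc) (renT suc) (Pointwise.map (renT-⟶* suc) (⟶args q b)))) t)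
  act-⟶E q (app t u) = app-⟶* (act-⟶E q t) (act-⟶E q u)
  act-⟶E q (mu c)    = gmap mu muC (actC-⟶E (⟶env (λ i → renN-⟶* suc (⟶vars q i))
      (λ { zero → refl ; (suc b) → cong suc (⟶names q b) })
      (λ { zero → [] ; (suc b) → Pointwise.map⁺ (renN suc) (renN suc) (Pointwise.map (renN-⟶* suc) (⟶args q b)) })) c)

  actC-⟶E : {E E' : Env n m n' m'} → E ⟶E E' → (c : Cmd n m) → actC E c ⟶c* actC E' c
  actC-⟶E {E = E} {E'} q (named b t) =
    subst (λ z → actC E (named b t) ⟶c* named z (apps (act E' t) (args E' b))) (⟶names q b)
      (gmap (named (names E b)) namedC (apps-⟶* (act-⟶E q t) (⟶args q b)))

renT-[0≔] : (ρ : Ren n n') (t : Tm (suc n) m) (u : Tm n m) →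
            renT ρ (t [0≔ u ]) ≡ renT (lift ρ) t [0≔ renT ρ u ]
renT-[0≔] ρ t u = begin
  renT ρ (sub (sub0 u) t)                         ≡⟨ cong (renT ρ) (sub-as-act _ t) ⟩
  renT ρ (act (subE (sub0 u)) t)                  ≡⟨ renT-act ρ _ t ⟩
  act (ρ ᵛ∘ subE (sub0 u)) t                      ≡⟨ act-cong (≈env (λ { zero → refl ; (suc i) → refl })
                                                                     (λ _ → refl) (λ _ → refl)) t ⟩
  act (subE (sub0 (renT ρ u)) ∘ᵛ lift ρ) t        ≡⟨ sym (act-renT _ (lift ρ) t) ⟩
  act (subE (sub0 (renT ρ u))) (renT (lift ρ) t)  ≡⟨ sym (sub-as-act _ (renT (lift ρ) t)) ⟩
  sub (sub0 (renT ρ u)) (renT (lift ρ) t)         ∎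

renN-[0≔] : (ρ : Ren m m') (t : Tm (suc n) m) (u : Tm n m) →
            renN ρ (t [0≔ u ]) ≡ renN ρ t [0≔ renN ρ u ]
renN-[0≔] ρ t u = begin
  renN ρ (sub (sub0 u) t)                         ≡⟨ cong (renN ρ) (sub-as-act _ t) ⟩
  renN ρ (act (subE (sub0 u)) t)                  ≡⟨ renN-act ρ _ t ⟩
  act (ρ ⁿ∘ subE (sub0 u)) t                      ≡⟨ act-cong (≈env (λ { zero → refl ; (suc i) → refl })
                                                                     (λ _ → refl) (λ _ → refl)) t ⟩
  act (subE (sub0 (renN ρ u)) ∘ⁿ ρ) t             ≡⟨ sym (act-renN _ ρ t) ⟩
  act (subE (sub0 (renN ρ u))) (renN ρ t)         ≡⟨ sym (sub-as-act _ (renN ρ t)) ⟩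
  sub (sub0 (renN ρ u)) (renN ρ t)                ∎

renTC-freshReplace0 : (ρ : Ren n n') (c : Cmd n (suc m)) (γ : Fin m) (u : Tm n m) →
                      renTC ρ (freshReplace0 c γ u) ≡ freshReplace0 (renTC ρ c) γ (renT ρ u)
renTC-freshReplace0 ρ c γ u = begin
  renTC ρ (repC (shiftTo γ) zero u c)                 ≡⟨ cong (renTC ρ) (repC-as-act _ zero u c) ⟩
  renTC ρ (actC (repE (shiftTo γ) zero u) c)          ≡⟨ renTC-actC ρ _ c ⟩
  actC (ρ ᵛ∘ repE (shiftTo γ) zero u) c               ≡⟨ actC-cong (≈env (λ _ → refl) (λ _ → refl)
                                                                           (λ b → sym (argsAt-map (renT ρ) zero u b))) c ⟩
  actC (repE (shiftTo γ) zero (renT ρ u) ∘ᵛ ρ) c      ≡⟨ sym (actC-renTC _ ρ c) ⟩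
  actC (repE (shiftTo γ) zero (renT ρ u)) (renTC ρ c) ≡⟨ sym (repC-as-act _ zero _ _) ⟩
  repC (shiftTo γ) zero (renT ρ u) (renTC ρ c)        ∎

renNC-freshReplace0 : (ρ : Ren m m') (c : Cmd n (suc m)) (γ : Fin m) (u : Tm n m) →
                      renNC ρ (freshReplace0 c γ u) ≡ freshReplace0 (renNC (lift ρ) c) (ρ γ) (renN ρ u)
renNC-freshReplace0 ρ c γ u = begin
  renNC ρ (repC (shiftTo γ) zero u c)                              ≡⟨ cong (renNC ρ) (repC-as-act _ zero u c) ⟩
  renNC ρ (actC (repE (shiftTo γ) zero u) c)                       ≡⟨ renNC-actC ρ _ c ⟩
  actC (ρ ⁿ∘ repE (shiftTo γ) zero u) c                            ≡⟨ actC-cong same c ⟩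
  actC (repE (shiftTo (ρ γ)) zero (renN ρ u) ∘ⁿ lift ρ) c          ≡⟨ sym (actC-renNC _ (lift ρ) c) ⟩
  actC (repE (shiftTo (ρ γ)) zero (renN ρ u)) (renNC (lift ρ) c)   ≡⟨ sym (repC-as-act _ zero _ _) ⟩
  repC (shiftTo (ρ γ)) zero (renN ρ u) (renNC (lift ρ) c)          ∎
  where
  same : (ρ ⁿ∘ repE (shiftTo γ) zero u) ≈E (repE (shiftTo (ρ γ)) zero (renN ρ u) ∘ⁿ lift ρ)
  same = ≈env (λ _ → refl) (λ { zero → refl ; (suc b) → refl }) (λ { zero → refl ; (suc b) → refl })

act-[0≔] : (E : Env n m n' m') (t : Tm (suc n) m) (u : Tm n m) → act E (t [0≔ u ]) ≡ act (E ⊙ subE (sub0 u)) t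
act-[0≔] E t u = trans (cong (act E) (sub-as-act _ t)) (act-⊙ E _ t)

actC-freshReplace0 : (E : Env n m n' m') (c : Cmd n (suc m)) (γ : Fin m) (u : Tm n m) →
                     actC E (freshReplace0 c γ u) ≡ actC (E ⊙ repE (shiftTo γ) zero u) c
actC-freshReplace0 E c γ u = trans (cong (actC E) (repC-as-act _ zero u c)) (actC-⊙ E _ c)

freshReplace0-new : (c : Cmd n (suc m)) (u : Tm n (suc m)) → freshReplace0 (renNC (lift suc) c) zero u ≡ replace0 c u
freshReplace0-new c u = begin
  repC (shiftTo zero) zero u (renNC (lift suc) c)          ≡⟨ repC-as-act _ zero u _ ⟩
  actC (repE (shiftTo zero) zero u) (renNC (lift suc) c)   ≡⟨ actC-renNC _ (lift suc) c ⟩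
  actC (repE (shiftTo zero) zero u ∘ⁿ lift suc) c          ≡⟨ actC-cong (≈env (λ _ → refl) (λ { zero → refl ; (suc b) → refl })
                                                                              (λ { zero → refl ; (suc b) → refl })) c ⟩
  actC (repE idR zero u) c                                 ≡⟨ sym (repC-as-act idR zero u c) ⟩
  replace0 c u                                             ∎

mutual
  ↓-renT : (ρ : Ren n n') (t : LMS.Tm n m) → ↓ (LMS.renT ρ t) ≡ renT ρ (↓ t)
  ↓-renT ρ (LMS.var i)    = refl
  ↓-renT ρ (LMS.lam t)    = cong lam (↓-renT (lift ρ) t)
  ↓-renT ρ (LMS.app t u)  = cong₂ app (↓-renT ρ t) (↓-renT ρ u)
  ↓-renT ρ (LMS.mu c)     = cong mu (↓-renTC ρ c)
  ↓-renT ρ (LMS.esub t s) = trans (cong₂ _[0≔_] (↓-renT (lift ρ) t) (↓-renT ρ s)) (sym (renT-[0≔] ρ (↓ t) (↓ s)))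

  ↓-renTC : (ρ : Ren n n') (c : LMS.Cmd n m) → ↓c (LMS.renTC ρ c) ≡ renTC ρ (↓c c)
  ↓-renTC ρ (LMS.named α t)  = cong (named α) (↓-renT ρ t)
  ↓-renTC ρ (LMS.erep c γ u) = trans (cong₂ (λ c' u' → freshReplace0 c' γ u') (↓-renTC ρ c) (↓-renT ρ u))
                                     (sym (renTC-freshReplace0 ρ (↓c c) γ (↓ u)))

mutual
  ↓-renN : (ρ : Ren m m') (t : LMS.Tm n m) → ↓ (LMS.renN ρ t) ≡ renN ρ (↓ t)
  ↓-renN ρ (LMS.var i)    = refl
  ↓-renN ρ (LMS.lam t)    = cong lam (↓-renN ρ t)
  ↓-renN ρ (LMS.app t u)  = cong₂ app (↓-renN ρ t) (↓-renN ρ u)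
  ↓-renN ρ (LMS.mu c)     = cong mu (↓-renNC (lift ρ) c)
  ↓-renN ρ (LMS.esub t s) = trans (cong₂ _[0≔_] (↓-renN ρ t) (↓-renN ρ s)) (sym (renN-[0≔] ρ (↓ t) (↓ s)))

  ↓-renNC : (ρ : Ren m m') (c : LMS.Cmd n m) → ↓c (LMS.renNC ρ c) ≡ renNC ρ (↓c c)
  ↓-renNC ρ (LMS.named α t)  = cong (named (ρ α)) (↓-renN ρ t)
  ↓-renNC ρ (LMS.erep c γ u) = trans (cong₂ (λ c' u' → freshReplace0 c' (ρ γ) u') (↓-renNC (lift ρ) c) (↓-renN ρ u))
                                     (sym (renNC-freshReplace0 ρ (↓c c) γ (↓ u)))

[0≔]-⟶*ˡ : {t t' : Tm (suc n) m} (u : Tm n m) → t ⟶* t' → (t [0≔ u ]) ⟶* (t' [0≔ u ])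
[0≔]-⟶*ˡ {t = t} {t'} u r = subst₂ _⟶*_ (sym (sub-as-act _ t)) (sym (sub-as-act _ t')) (act-⟶* (subE (sub0 u)) r)

[0≔]-⟶*ʳ : (t : Tm (suc n) m) {u u' : Tm n m} → u ⟶* u' → (t [0≔ u ]) ⟶* (t [0≔ u' ])
[0≔]-⟶*ʳ t r = subst₂ _⟶*_ (sym (sub-as-act _ t)) (sym (sub-as-act _ t))
  (act-⟶E (⟶env (λ { zero → r ; (suc i) → ε }) (λ _ → refl) (λ _ → [])) t)

freshReplace0-⟶*ˡ : {c c' : Cmd n (suc m)} (γ : Fin m) (u : Tm n m) →
                    c ⟶c* c' → freshReplace0 c γ u ⟶c* freshReplace0 c' γ u
freshReplace0-⟶*ˡ {c = c} {c'} γ u r =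
  subst₂ _⟶c*_ (sym (repC-as-act _ zero u c)) (sym (repC-as-act _ zero u c')) (actC-⟶* (repE (shiftTo γ) zero u) r)

freshReplace0-⟶*ʳ : (c : Cmd n (suc m)) (γ : Fin m) {u u' : Tm n m} →
                    u ⟶* u' → freshReplace0 c γ u ⟶c* freshReplace0 c γ u'
freshReplace0-⟶*ʳ c γ r = subst₂ _⟶c*_ (sym (repC-as-act _ zero _ c)) (sym (repC-as-act _ zero _ c))
  (actC-⟶E (⟶env (λ _ → ε) (λ _ → refl) (λ { zero → r ∷ [] ; (suc b) → [] })) c)

[0≔]-weakenT : (t : Tm n m) (u : Tm n m) → renT suc t [0≔ u ] ≡ t
[0≔]-weakenT t u = trans (sub-as-act _ (renT suc t)) (sub0-weakenT u t)

freshReplace0-weakenN : (c : Cmd n m) (γ : Fin m) (u : Tm n m) → freshReplace0 (renNC suc c) γ u ≡ c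
freshReplace0-weakenN c γ u = trans (repC-as-act _ zero u (renNC suc c))
  (trans (actC-renNC _ suc c) (actC-id idE-isId c))

act-↓-weakenT : (E : Env n m n' m') (v : LMS.Tm n m) → act (underλ E) (↓ (LMS.renT suc v)) ≡ renT suc (act E (↓ v))
act-↓-weakenT E v = trans (cong (act (underλ E)) (↓-renT suc v)) (act-weakenT E (↓ v))

act-↓-weakenN : (E : Env n m n' m') (v : LMS.Tm n m) → act (underμ E) (↓ (LMS.renN suc v)) ≡ renN suc (act E (↓ v))
act-↓-weakenN E v = trans (cong (act (underμ E)) (↓-renN suc v)) (act-weakenN E (↓ v))

mutual
  hit-act : {x : Fin n} {v t t' : LMS.Tm n m} → LMS.Hit x v t t' → (E : Env n m n' m') →
            act E (↓ v) ≡ vars E x → act E (↓ t) ≡ act E (↓ t')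
  hit-act LMS.here E p = sym p
  hit-act {v = v} (LMS.lamH h) E p = cong lam (hit-act h (underλ E) (trans (act-↓-weakenT E v) (cong (renT suc) p)))
  hit-act {t = LMS.app _ s} (LMS.appL h) E p = cong (λ z → app z (act E (↓ s))) (hit-act h E p)
  hit-act {t = LMS.app t _} (LMS.appR h) E p = cong (app (act E (↓ t))) (hit-act h E p)
  hit-act {v = v} (LMS.muH h) E p = cong mu (hitC-act h (underμ E) (trans (act-↓-weakenN E v) (cong (renN suc) p)))
  hit-act {v = v} {t = LMS.esub t s} {LMS.esub t' _} (LMS.esubL h) E p = begin
    act E (↓ t [0≔ ↓ s ])  ≡⟨ act-[0≔] E (↓ t) (↓ s) ⟩
    act E' (↓ t)           ≡⟨ hit-act h E' (trans (cong (act E') (↓-renT suc v))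
                                                  (trans (act-renT E' suc (↓ v)) p)) ⟩
    act E' (↓ t')          ≡⟨ sym (act-[0≔] E (↓ t') (↓ s)) ⟩
    act E (↓ t' [0≔ ↓ s ]) ∎
    where E' = E ⊙ subE (sub0 (↓ s))
  hit-act {t = LMS.esub t s} {LMS.esub _ s'} (LMS.esubR h) E p = begin
    act E (↓ t [0≔ ↓ s ])              ≡⟨ act-[0≔] E (↓ t) (↓ s) ⟩
    act (E ⊙ subE (sub0 (↓ s))) (↓ t)  ≡⟨ act-cong (≈env (λ { zero → hit-act h E p ; (suc i) → refl })
                                                         (λ _ → refl) (λ _ → refl)) (↓ t) ⟩
    act (E ⊙ subE (sub0 (↓ s'))) (↓ t) ≡⟨ sym (act-[0≔] E (↓ t) (↓ s')) ⟩
    act E (↓ t [0≔ ↓ s' ])             ∎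

  hitC-act : {x : Fin n} {v : LMS.Tm n m} {c c' : LMS.Cmd n m} → LMS.HitC x v c c' → (E : Env n m n' m') →
             act E (↓ v) ≡ vars E x → actC E (↓c c) ≡ actC E (↓c c')
  hitC-act {c = LMS.named b _} (LMS.namedH h) E p = cong (λ z → named (names E b) (apps z (args E b))) (hit-act h E p)
  hitC-act {v = v} {c = LMS.erep c γ s} {LMS.erep c' _ _} (LMS.erepL h) E p = begin
    actC E (freshReplace0 (↓c c) γ (↓ s))  ≡⟨ actC-freshReplace0 E (↓c c) γ (↓ s) ⟩
    actC E' (↓c c)                         ≡⟨ hitC-act h E' (trans (cong (act E') (↓-renN suc v))
                                                                  (trans (act-renN E' suc (↓ v)) p)) ⟩
    actC E' (↓c c')                        ≡⟨ sym (actC-freshReplace0 E (↓c c') γ (↓ s)) ⟩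
    actC E (freshReplace0 (↓c c') γ (↓ s)) ∎
    where E' = E ⊙ repE (shiftTo γ) zero (↓ s)
  hitC-act {c = LMS.erep c γ s} {LMS.erep _ _ s'} (LMS.erepR h) E p = begin
    actC E (freshReplace0 (↓c c) γ (↓ s))          ≡⟨ actC-freshReplace0 E (↓c c) γ (↓ s) ⟩
    actC (E ⊙ repE (shiftTo γ) zero (↓ s)) (↓c c)  ≡⟨ actC-cong (≈env (λ _ → refl) (λ _ → refl)
                                                        (λ { zero → cong (_∷ args E γ) (hit-act h E p) ; (suc b) → refl })) (↓c c) ⟩
    actC (E ⊙ repE (shiftTo γ) zero (↓ s')) (↓c c) ≡⟨ sym (actC-freshReplace0 E (↓c c) γ (↓ s')) ⟩
    actC E (freshReplace0 (↓c c) γ (↓ s'))         ∎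

mutual
  nhitC-act : {α γ : Fin m} {v : LMS.Tm n m} {c c' : LMS.Cmd n m} → LMS.NHitC α γ v c c' → (E : Env n m n' m') →
              names E α ≡ names E γ → args E α ≡ act E (↓ v) ∷ args E γ → actC E (↓c c) ≡ actC E (↓c c')
  nhitC-act {c = LMS.named _ t} LMS.here E pn pa = cong₂ named pn (cong (apps (act E (↓ t))) pa)
  nhitC-act {c = LMS.named b _} (LMS.namedH h) E pn pa = cong (λ z → named (names E b) (apps z (args E b))) (nhit-act h E pn pa)
  nhitC-act {γ = γ} {v} {LMS.erep c δ s} {LMS.erep c' _ _} (LMS.erepL h) E pn pa = begin
    actC E (freshReplace0 (↓c c) δ (↓ s))  ≡⟨ actC-freshReplace0 E (↓c c) δ (↓ s) ⟩
    actC E' (↓c c)                         ≡⟨ nhitC-act h E' pn (trans pa (cong (_∷ args E γ) (sym v-image))) ⟩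
    actC E' (↓c c')                        ≡⟨ sym (actC-freshReplace0 E (↓c c') δ (↓ s)) ⟩
    actC E (freshReplace0 (↓c c') δ (↓ s)) ∎
    where
    E' = E ⊙ repE (shiftTo δ) zero (↓ s)
    v-image : act E' (↓ (LMS.renN suc v)) ≡ act E (↓ v)
    v-image = trans (cong (act E') (↓-renN suc v)) (act-renN E' suc (↓ v))
  nhitC-act {c = LMS.erep c δ s} {LMS.erep _ _ s'} (LMS.erepR h) E pn pa = begin
    actC E (freshReplace0 (↓c c) δ (↓ s))          ≡⟨ actC-freshReplace0 E (↓c c) δ (↓ s) ⟩
    actC (E ⊙ repE (shiftTo δ) zero (↓ s)) (↓c c)  ≡⟨ actC-cong (≈env (λ _ → refl) (λ _ → refl)
                                                        (λ { zero → cong (_∷ args E δ) (nhit-act h E pn pa) ; (suc b) → refl })) (↓c c) ⟩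
    actC (E ⊙ repE (shiftTo δ) zero (↓ s')) (↓c c) ≡⟨ sym (actC-freshReplace0 E (↓c c) δ (↓ s')) ⟩
    actC E (freshReplace0 (↓c c) δ (↓ s'))         ∎

  nhit-act : {α γ : Fin m} {v t t' : LMS.Tm n m} → LMS.NHit α γ v t t' → (E : Env n m n' m') →
             names E α ≡ names E γ → args E α ≡ act E (↓ v) ∷ args E γ → act E (↓ t) ≡ act E (↓ t')
  nhit-act {γ = γ} {v} (LMS.lamH h) E pn pa = cong lam (nhit-act h (underλ E) pn
    (trans (cong (map (renT suc)) pa) (cong (_∷ map (renT suc) (args E γ)) (sym (act-↓-weakenT E v)))))
  nhit-act {t = LMS.app _ s} (LMS.appL h) E pn pa = cong (λ z → app z (act E (↓ s))) (nhit-act h E pn pa)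
  nhit-act {t = LMS.app t _} (LMS.appR h) E pn pa = cong (app (act E (↓ t))) (nhit-act h E pn pa)
  nhit-act {γ = γ} {v} (LMS.muH h) E pn pa = cong mu (nhitC-act h (underμ E) (cong suc pn)
    (trans (cong (map (renN suc)) pa) (cong (_∷ map (renN suc) (args E γ)) (sym (act-↓-weakenN E v)))))
  nhit-act {γ = γ} {v} {LMS.esub t s} {LMS.esub t' _} (LMS.esubL h) E pn pa = begin
    act E (↓ t [0≔ ↓ s ])  ≡⟨ act-[0≔] E (↓ t) (↓ s) ⟩
    act E' (↓ t)           ≡⟨ nhit-act h E' pn (trans pa (cong (_∷ args E γ) (sym v-image))) ⟩
    act E' (↓ t')          ≡⟨ sym (act-[0≔] E (↓ t') (↓ s)) ⟩
    act E (↓ t' [0≔ ↓ s ]) ∎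
    where
    E' = E ⊙ subE (sub0 (↓ s))
    v-image : act E' (↓ (LMS.renT suc v)) ≡ act E (↓ v)
    v-image = trans (cong (act E') (↓-renT suc v)) (act-renT E' suc (↓ v))
  nhit-act {t = LMS.esub t s} {LMS.esub _ s'} (LMS.esubR h) E pn pa = begin
    act E (↓ t [0≔ ↓ s ])              ≡⟨ act-[0≔] E (↓ t) (↓ s) ⟩
    act (E ⊙ subE (sub0 (↓ s))) (↓ t)  ≡⟨ act-cong (≈env (λ { zero → nhit-act h E pn pa ; (suc i) → refl })
                                                         (λ _ → refl) (λ _ → refl)) (↓ t) ⟩
    act (E ⊙ subE (sub0 (↓ s'))) (↓ t) ≡⟨ sym (act-[0≔] E (↓ t) (↓ s')) ⟩
    act E (↓ t [0≔ ↓ s' ])             ∎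

envL : LMS.LC n m k → Env k m n m
envL LMS.hole       = idE
envL (L LMS.[/ u ]) = subE (sub0 (↓ u)) ⊙ envL L

↓-plugL : (L : LMS.LC n m k) (t : LMS.Tm k m) → ↓ (LMS.plugL L t) ≡ act (envL L) (↓ t)
↓-plugL LMS.hole       t = sym (act-id idE-isId (↓ t))
↓-plugL (L LMS.[/ u ]) t = begin
  ↓ (LMS.plugL L t) [0≔ ↓ u ]                 ≡⟨ sub-as-act _ (↓ (LMS.plugL L t)) ⟩
  act (subE (sub0 (↓ u))) (↓ (LMS.plugL L t)) ≡⟨ cong (act (subE (sub0 (↓ u)))) (↓-plugL L t) ⟩
  act (subE (sub0 (↓ u))) (act (envL L) (↓ t)) ≡⟨ act-⊙ _ (envL L) (↓ t) ⟩
  act (envL (L LMS.[/ u ])) (↓ t)             ∎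

↓-wkL : (L : LMS.LC n m k) (u : LMS.Tm n m) → act (envL L) (↓ (LMS.wkL L u)) ≡ ↓ u
↓-wkL LMS.hole       u = act-id idE-isId (↓ u)
↓-wkL (L LMS.[/ v ]) u = begin
  act (S ⊙ envL L) (↓ u')         ≡⟨ sym (act-⊙ S (envL L) (↓ u')) ⟩
  act S (act (envL L) (↓ u'))     ≡⟨ cong (act S) (↓-wkL L (LMS.renT suc u)) ⟩
  act S (↓ (LMS.renT suc u))      ≡⟨ cong (act S) (↓-renT suc u) ⟩
  act S (renT suc (↓ u))          ≡⟨ sub0-weakenT (↓ v) (↓ u) ⟩
  ↓ u                             ∎
  where
  S  = subE (sub0 (↓ v))
  u' = LMS.wkL L (LMS.renT suc u)

step-modulo-≡ : {t t₀ u₀ u : Tm n m} → t ≡ t₀ → t₀ ⟶ u₀ → u ≡ u₀ → t ⟶* u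
step-modulo-≡ refl r refl = r ◅ ε

≡⇒⟶* : {t u : Tm n m} → t ≡ u → t ⟶* u
≡⇒⟶* refl = ε

≡⇒⟶c* : {c d : Cmd n m} → c ≡ d → c ⟶c* d
≡⇒⟶c* refl = ε

dB-simulation : (L : LMS.LC n m k) (t : LMS.Tm (suc k) m) (u : LMS.Tm n m) →
                ↓ (LMS.app (LMS.plugL L (LMS.lam t)) u) ⟶* ↓ (LMS.plugL L (LMS.esub t (LMS.wkL L u)))
dB-simulation L t u = step-modulo-≡ (cong (λ z → app z (↓ u)) (↓-plugL L (LMS.lam t))) β (begin
  ↓ (LMS.plugL L (LMS.esub t W))               ≡⟨ ↓-plugL L (LMS.esub t W) ⟩
  act E (↓ t [0≔ ↓ W ])                        ≡⟨ sym (act-β E (↓ t) (↓ W)) ⟩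
  act (underλ E) (↓ t) [0≔ act E (↓ W) ]       ≡⟨ cong (act (underλ E) (↓ t) [0≔_]) (↓-wkL L u) ⟩
  act (underλ E) (↓ t) [0≔ ↓ u ]               ∎)
  where
  E = envL L
  W = LMS.wkL L u

dM-simulation : (L : LMS.LC n m k) (c : LMS.Cmd k (suc m)) (u : LMS.Tm n m) →
                ↓ (LMS.app (LMS.plugL L (LMS.mu c)) u) ⟶*
                ↓ (LMS.plugL L (LMS.mu (LMS.erep (LMS.renNC (lift suc) c) zero (LMS.renN suc (LMS.wkL L u)))))
dM-simulation L c u = step-modulo-≡ (cong (λ z → app z (↓ u)) (↓-plugL L (LMS.mu c))) μ (begin
  ↓ (LMS.plugL L (LMS.mu (LMS.erep (LMS.renNC (lift suc) c) zero (LMS.renN suc W))))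
    ≡⟨ ↓-plugL L _ ⟩
  mu (actC (underμ E) (freshReplace0 (↓c (LMS.renNC (lift suc) c)) zero (↓ (LMS.renN suc W))))
    ≡⟨ cong₂ (λ c' u' → mu (actC (underμ E) (freshReplace0 c' zero u'))) (↓-renNC (lift suc) c) (↓-renN suc W) ⟩
  mu (actC (underμ E) (freshReplace0 (renNC (lift suc) (↓c c)) zero (renN suc (↓ W))))
    ≡⟨ cong (λ z → mu (actC (underμ E) z)) (freshReplace0-new (↓c c) (renN suc (↓ W))) ⟩
  mu (actC (underμ E) (replace0 (↓c c) (renN suc (↓ W))))
    ≡⟨ cong mu (sym (act-μ E (↓c c) (↓ W))) ⟩
  mu (replace0 (actC (underμ E) (↓c c)) (renN suc (act E (↓ W))))
    ≡⟨ cong (λ z → mu (replace0 (actC (underμ E) (↓c c)) (renN suc z))) (↓-wkL L u) ⟩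
  mu (replace0 (actC (underμ E) (↓c c)) (renN suc (↓ u)))
    ∎)
  where
  E = envL L
  W = LMS.wkL L u

-- The substitution rules sDup and sLin do not change the projection.
hit-[0≔] : {t t' : LMS.Tm (suc n) m} {u : LMS.Tm n m} → LMS.Hit zero (LMS.renT suc u) t t' →
           ↓ t [0≔ ↓ u ] ≡ ↓ t' [0≔ ↓ u ]
hit-[0≔] {t = t} {t'} {u} h = begin
  ↓ t [0≔ ↓ u ]  ≡⟨ sub-as-act _ (↓ t) ⟩
  act S (↓ t)    ≡⟨ hit-act h S (trans (cong (act S) (↓-renT suc u)) (sub0-weakenT (↓ u) (↓ u))) ⟩
  act S (↓ t')   ≡⟨ sym (sub-as-act _ (↓ t')) ⟩
  ↓ t' [0≔ ↓ u ] ∎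
  where S = subE (sub0 (↓ u))

-- The replacement rules rDup and rLin do not change the projection.
nhit-freshReplace0 : {c c' : LMS.Cmd n (suc m)} {γ : Fin m} {u : LMS.Tm n m} →
                     LMS.NHitC zero (suc γ) (LMS.renN suc u) c c' →
                     freshReplace0 (↓c c) γ (↓ u) ≡ freshReplace0 (↓c c') γ (↓ u)
nhit-freshReplace0 {c = c} {c'} {γ} {u} h = begin
  freshReplace0 (↓c c) γ (↓ u)  ≡⟨ repC-as-act _ zero _ (↓c c) ⟩
  actC R (↓c c)                 ≡⟨ nhitC-act h R refl (cong (_∷ []) (sym u-image)) ⟩
  actC R (↓c c')                ≡⟨ sym (repC-as-act _ zero _ (↓c c')) ⟩
  freshReplace0 (↓c c') γ (↓ u) ∎
  where
  R = repE (shiftTo γ) zero (↓ u)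
  u-image : act R (↓ (LMS.renN suc u)) ≡ ↓ u
  u-image = trans (cong (act R) (↓-renN suc u))
                  (trans (act-renN R suc (↓ u)) (act-id (isId (λ _ → refl) (λ _ → refl) (λ _ → refl)) (↓ u)))

mutual
  ↓-simulates : {t t' : LMS.Tm n m} → t LMS.⟶ t' → ↓ t ⟶* ↓ t'
  ↓-simulates (LMS.dB L {t} {u})          = dB-simulation L t u
  ↓-simulates (LMS.dM L {c} {u})          = dM-simulation L c u
  ↓-simulates (LMS.sDup h _)              = ≡⇒⟶* (hit-[0≔] h)
  ↓-simulates (LMS.sLin {u = u} t'' h _)  = ≡⇒⟶* (trans (hit-[0≔] h)
                                              (trans (cong (_[0≔ ↓ u ]) (↓-renT suc t'')) ([0≔]-weakenT (↓ t'') (↓ u))))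
  ↓-simulates (LMS.sGc {t = t} {u})       = ≡⇒⟶* (trans (cong (_[0≔ ↓ u ]) (↓-renT suc t)) ([0≔]-weakenT (↓ t) (↓ u)))
  ↓-simulates (LMS.lamC r)                = gmap lam lamC (↓-simulates r)
  ↓-simulates (LMS.appL r)                = gmap (λ z → app z _) appL (↓-simulates r)
  ↓-simulates (LMS.appR r)                = gmap (app _) appR (↓-simulates r)
  ↓-simulates (LMS.muC r)                 = gmap mu muC (↓c-simulates r)
  ↓-simulates (LMS.esubL {u = u} r)       = [0≔]-⟶*ˡ (↓ u) (↓-simulates r)
  ↓-simulates (LMS.esubR {t = t} r)       = [0≔]-⟶*ʳ (↓ t) (↓-simulates r)

  ↓c-simulates : {c c' : LMS.Cmd n m} → c LMS.⟶c c' → ↓c c ⟶c* ↓c c'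
  ↓c-simulates (LMS.rDup h _)                   = ≡⇒⟶c* (nhit-freshReplace0 h)
  ↓c-simulates (LMS.rLin {γ = γ} {u} c'' h _)   = ≡⇒⟶c* (trans (nhit-freshReplace0 h)
                                                    (trans (cong (λ z → freshReplace0 z γ (↓ u)) (↓-renNC suc c''))
                                                           (freshReplace0-weakenN (↓c c'') γ (↓ u))))
  ↓c-simulates (LMS.rGc {c = c} {γ} {u})        = ≡⇒⟶c* (trans (cong (λ z → freshReplace0 z γ (↓ u)) (↓-renNC suc c))
                                                                (freshReplace0-weakenN (↓c c) γ (↓ u)))
  ↓c-simulates (LMS.namedC r)                   = gmap (named _) namedC (↓-simulates r)
  ↓c-simulates (LMS.erepL {β = γ} {u} r)        = freshReplace0-⟶*ˡ γ (↓ u) (↓c-simulates r)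
  ↓c-simulates (LMS.erepR {c = c} {β = γ} r)    = freshReplace0-⟶*ʳ (↓c c) γ (↓-simulates r)

lemma7p2 : (∀ {n m} {t t' : LMS.Tm n m} → LMS._⟶_ t t' → LM._⟶*_ (↓ t) (↓ t'))
         × (∀ {n m} {c c' : LMS.Cmd n m} → LMS._⟶c_ c c' → LM._⟶c*_ (↓c c) (↓c c'))
lemma7p2 = ↓-simulates , ↓c-simulates
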